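{- Let $H$ be a pseudoexpander, $M$ a pseudomatching of $H$, and $S$ a set of literals with $Vars(S)=V(H)\setminus\bigcup M$ that falsifies no clause of $\phi_H$ and respects every pseudoedge of $M$. Let $\{t_i,t_j\}\in M$ and let $\{t_i,t_{j'}\}\ne\{t_i,t_j\}$ be another pseudoedge of $H$. Then $S$ contains the positive literal of at least one internal variable of $C_{i,j'}$.
   Context: Binary-tree-based graph: $H$ is an edge-disjoint union of extended rooted trees (no leaf has a sibling) $T_1,\dots,T_m$ with roots $t_1,\dots,t_m$, each vertex that is a leaf of some $T_i$ is a leaf of exactly two trees, and any two trees share at most one vertex, a leaf of both. Root variables are the roots, leaf variables the leaves of the trees, internal variables the remaining vertices (each in exactly one tree); internal vertices are siblings if they lie in the same $T_i$ and are siblings there. If $T_i,T_j$ share a leaf $\ell_{i,j}$, $\{t_i,t_j\}$ is a pseudoedge and $P_{i,j}$ is the path from $t_i$ to $t_j$ in $T_i\cup T_j$; the variables of clause $C_{i,j}$ are $V(P_{i,j})$, its internal variables those in $V(P_{i,j})\setminus\{t_i,t_j,\ell_{i,j}\}$. A pseudomatching $M$ is a set of pseudoedges with pairwise disjoint ends, $\bigcup M$ the set of ends. $H$ is a pseudoexpander if every tree has height (max vertices on a root–leaf path) $\le(\log_2 m)/4.9+3$ and any two disjoint root sets of size $\ge m^{0.999}$ admit a pseudomatching of size $\ge m^{0.999}/3$ with each pseudoedge having one end in each. $\phi_H$: monotone CNF over $V(H)$ with clauses $C_{i,j}=\bigvee_{v\in V(P_{i,j})}v$, one per pseudoedge. Sets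 of literals never contain a variable with its negation; $S$ falsifies a clause if all its variables occur negatively in $S$; $S$ respects $\{t_i,t_j\}$ if all non-root variables of $C_{i,j}$ occur negatively in $S$ and all siblings of internal variables of $C_{i,j}$ occur positively in $S$. -}

module Defs where

open import Data.Nat using (ℕ; suc; _*_; _∸_; _^_; _≤_)
open import Data.Fin using (Fin)
open import Data.Product using (Σ; ∃; ∃-syntax; _×_; _,_; proj₁; proj₂)
open import Data.Sum using (_⊎_)
open import Data.Empty using (⊥)
open import Data.List using (List; []; _∷_; concatMap; length)
open import Data.List.Relation.Unary.All using (All)
open import Data.List.Relation.Unary.Unique.Propositional using (Unique)
import Data.List.Membership.Propositional as L
open import Data.Fin.Subset as FS using (Subset; ∣_∣)
open import Relation.Nullary using (¬_)
open import Relation.Binary.PropositionalEquality using (_≡_; _≢_)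

-- Raw data of a family of m rooted trees T_0 … T_{m-1} on the vertex
-- set Fin n.  Tree T_i has vertex set {v | InT i v}, root (root i), and
-- every non-root vertex v of T_i has parent (par i v) in T_i.  (par i v
-- is junk when v is the root or not in T_i.)

record Forest (n m : ℕ) : Set₁ where
  field
    InT  : Fin m → Fin n → Set
    root : Fin m → Fin n
    par  : Fin m → Fin n → Fin n

module _ {n m : ℕ} (H : Forest n m) where
  open Forest H

  data Depth (i : Fin m) : Fin n → ℕ → Set where
    d-root : Depth i (root i) 1
    d-step : ∀ {v k} → InT i v → v ≢ root i →
             Depth i (par i v) k → Depth i v (suc k)

  data Anc (i : Fin m) (a : Fin n) : Fin n → Set where
    a-here : Anc i a a
    a-up   : ∀ {v} → v ≢ root i → Anc i a (par i v) → Anc i a v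

  Child : Fin m → Fin n → Fin n → Set
  Child i c v = InT i c × c ≢ root i × par i c ≡ v

  IsLeaf : Fin m → Fin n → Set
  IsLeaf i v = InT i v × (∀ c → ¬ Child i c v)

  SibT : Fin m → Fin n → Fin n → Set
  SibT i v w = v ≢ w × InT i v × InT i w × v ≢ root i × w ≢ root i
               × par i v ≡ par i w

  IsRootVar : Fin n → Set
  IsRootVar v = ∃[ k ] v ≡ root k

  IsLeafVar : Fin n → Set
  IsLeafVar v = ∃[ k ] IsLeaf k v

  Internal : Fin n → Set
  Internal v = ¬ IsRootVar v × ¬ IsLeafVar v

  Sib : Fin n → Fin n → Set
  Sib v w = Internal v × Internal w × ∃[ i ] SibT i v w

  record IsBTG : Set where
    field
      root-in  : ∀ i → InT i (root i)
      par-in   : ∀ i v → InT i v → v ≢ root i → InT i (par i v)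
      reach    : ∀ i v → InT i v → ∃[ k ] Depth i v k
      extended : ∀ i ℓ w → IsLeaf i ℓ → ¬ SibT i ℓ w
      leaf-two : ∀ i v → IsLeaf i v →
                 ∃[ j ] (j ≢ i × IsLeaf j v ×
                         (∀ k → IsLeaf k v → k ≡ i ⊎ k ≡ j))
      share    : ∀ i j → i ≢ j → ∀ v → InT i v → InT j v →
                 IsLeaf i v × IsLeaf j v ×
                 (∀ w → InT i w → InT j w → w ≡ v)
      cover    : ∀ v → ∃[ i ] InT i v

  -- {t_i, t_j} is a pseudoedge, witnessed by the shared leaf ℓ = ℓ_{i,j}
  PseudoEdge : Fin m → Fin m → Fin n → Set
  PseudoEdge i j ℓ = i ≢ j × IsLeaf i ℓ × IsLeaf j ℓ

  -- v ∈ V(P_{i,j}) : the path t_i … ℓ … t_j in T_i ∪ T_j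
  OnPath : Fin m → Fin m → Fin n → Fin n → Set
  OnPath i j ℓ v = Anc i v ℓ ⊎ Anc j v ℓ

  InternalOf : Fin m → Fin m → Fin n → Fin n → Set
  InternalOf i j ℓ v = OnPath i j ℓ v × v ≢ root i × v ≢ root j × v ≢ ℓ

  -- set of ends ⋃M of a list of pseudoedges (as root vertices)
  Ends : List (Fin m × Fin m) → List (Fin n)
  Ends = concatMap (λ p → root (proj₁ p) ∷ root (proj₂ p) ∷ [])

  Pseudomatching : List (Fin m × Fin m) → Set
  Pseudomatching M =
    All (λ p → ∃[ ℓ ] PseudoEdge (proj₁ p) (proj₂ p) ℓ) M × Unique (Ends M)

  -- Arithmetic encoding (all in ℕ):
  --   k ≤ (log₂ m)/4.9 + 3   ⇔   2^(49·(k∸3)) ≤ m^10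
  --   x ≥ m^0.999            ⇔   x^1000 ≥ m^999
  --   x ≥ m^0.999 / 3        ⇔   (3x)^1000 ≥ m^999
  record IsPseudoexpander : Set where
    field
      btg    : IsBTG
      height : ∀ i v k → IsLeaf i v → Depth i v k →
               2 ^ (49 * (k ∸ 3)) ≤ m ^ 10
      expand : ∀ (A B : Subset n) →
               (∀ v → v FS.∈ A → IsRootVar v) →
               (∀ v → v FS.∈ B → IsRootVar v) →
               (∀ v → ¬ (v FS.∈ A × v FS.∈ B)) →
               m ^ 999 ≤ ∣ A ∣ ^ 1000 → m ^ 999 ≤ ∣ B ∣ ^ 1000 →
               ∃[ M ] (Pseudomatching M ×
                       m ^ 999 ≤ (3 * length M) ^ 1000 ×
                       All (λ p → (root (proj₁ p) FS.∈ A × root (proj₂ p) FS.∈ B)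
                                ⊎ (root (proj₂ p) FS.∈ A × root (proj₁ p) FS.∈ B)) M)

data Lit (n : ℕ) : Set where
  pos : Fin n → Lit n
  neg : Fin n → Lit n

module _ {n m : ℕ} (H : Forest n m) (S : Lit n → Set) where
  open Forest H

  Consistent : Set
  Consistent = ∀ v → ¬ (S (pos v) × S (neg v))

  Vars : Fin n → Set
  Vars v = S (pos v) ⊎ S (neg v)

  Falsifies : Fin m → Fin m → Fin n → Set
  Falsifies i j ℓ = ∀ v → OnPath H i j ℓ v → S (neg v)

  Respects : Fin m → Fin m → Fin n → Set
  Respects i j ℓ =
    (∀ v → OnPath H i j ℓ v → ¬ IsRootVar H v → S (neg v)) ×
    (∀ v w → InternalOf H i j ℓ v → Sib H v w → S (pos w))

module Submission where

-- Two distinct leaves ℓ, ℓ' of T_i diverge at some vertex p: p has a child c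
-- on the path to ℓ and a different child w on the path to ℓ'.  Since M
-- contains {t_i, t_j} and S respects it, c is an internal variable of
-- C_{i,j}, so its sibling w is positive in S; and w is an internal variable
-- of C_{i,j'}.  The leaves are distinct because a leaf lies in exactly two
-- trees, so ℓ = ℓ' would force t_j = t_{j'}.

open import Defs
open import Data.Nat using (ℕ)
open import Data.Fin using (Fin; _≟_)
open import Data.Product using (∃-syntax; _×_; _,_; proj₁; proj₂)
open import Data.Sum using (_⊎_; inj₁; inj₂)
open import Data.List using (List)
open import Data.List.Membership.Propositional using (_∈_; _∉_)
open import Data.Empty using (⊥-elim)
open import Relation.Nullary using (¬_; Dec; yes; no)
open import Relation.Binary.PropositionalEquality
  using (_≡_; _≢_; refl; sym; trans; cong; subst; ≢-sym)

module Paths {n m : ℕ} (H : Forest n m) where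
  open Forest H

  Depth⇒Anc-root : ∀ {i v k} → Depth H i v k → Anc H i (root i) v
  Depth⇒Anc-root d-root           = a-here
  Depth⇒Anc-root (d-step _ v≢r d) = a-up v≢r (Depth⇒Anc-root d)

  Anc? : ∀ {i v k} a → Depth H i v k → Dec (Anc H i a v)
  Anc? {v = v} a d with a ≟ v
  ... | yes refl = yes a-here
  Anc? a d-root | no a≢v = no λ { a-here → a≢v refl ; (a-up r≢r _) → r≢r refl }
  Anc? a (d-step _ v≢r d) | no a≢v with Anc? a d
  ... | yes p = yes (a-up v≢r p)
  ... | no ¬p = no λ { a-here → a≢v refl ; (a-up _ p) → ¬p p }

  child-on-path : ∀ {i a v} → Anc H i a v → a ≢ v →
                  ∃[ c ] (Anc H i c v × c ≢ root i × par i c ≡ a)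
  child-on-path a-here a≢a = ⊥-elim (a≢a refl)
  child-on-path {i} {a} (a-up {v} v≢r p) a≢v with a ≟ par i v
  ... | yes refl = v , a-here , v≢r , refl
  ... | no a≢pv with child-on-path p a≢pv
  ...   | c , c-anc , c≢r , pc≡a = c , a-up v≢r c-anc , c≢r , pc≡a

  lowest-ancestor-off-path : ∀ {i x ℓ k kℓ} → Depth H i ℓ kℓ → Depth H i x k →
    ¬ Anc H i x ℓ →
    ∃[ w ] (Anc H i w x × ¬ Anc H i w ℓ × w ≢ root i × Anc H i (par i w) ℓ)
  lowest-ancestor-off-path dℓ d-root ¬x = ⊥-elim (¬x (Depth⇒Anc-root dℓ))
  lowest-ancestor-off-path {i} {x} dℓ (d-step _ x≢r d) ¬x with Anc? (par i x) dℓ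
  ... | yes px = x , a-here , ¬x , x≢r , px
  ... | no ¬px with lowest-ancestor-off-path dℓ d ¬px
  ...   | w , w-anc , rest = w , a-up x≢r w-anc , rest

PseudoEdge-swap : ∀ {n m} {H : Forest n m} {i j ℓ} →
                  PseudoEdge H i j ℓ → PseudoEdge H j i ℓ
PseudoEdge-swap (i≢j , ℓi , ℓj) = ≢-sym i≢j , ℓj , ℓi

InternalOf-swap : ∀ {n m} {H : Forest n m} {i j ℓ v} →
                  InternalOf H i j ℓ v → InternalOf H j i ℓ v
InternalOf-swap (inj₁ p , v≢ti , v≢tj , v≢ℓ) = inj₂ p , v≢tj , v≢ti , v≢ℓ
InternalOf-swap (inj₂ p , v≢ti , v≢tj , v≢ℓ) = inj₁ p , v≢tj , v≢ti , v≢ℓ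

module TreeBased {n m : ℕ} (H : Forest n m) (btg : IsBTG H) where
  open Forest H
  open IsBTG btg
  open Paths H

  Anc⇒InT : ∀ {i a v} → InT i v → Anc H i a v → InT i a
  Anc⇒InT v∈ a-here            = v∈
  Anc⇒InT {i} v∈ (a-up v≢r p) = Anc⇒InT (par-in i _ v∈ v≢r) p

  leaf-ancestor-is-self : ∀ {i a ℓ} → IsLeaf H i a → InT i ℓ → Anc H i a ℓ → a ≡ ℓ
  leaf-ancestor-is-self {i} {a} {ℓ} a-leaf ℓ∈ p with a ≟ ℓ
  ... | yes a≡ℓ = a≡ℓ
  ... | no a≢ℓ with child-on-path p a≢ℓ
  ...   | c , c-anc , c≢r , pc≡a = ⊥-elim (proj₂ a-leaf c (Anc⇒InT ℓ∈ c-anc , c≢r , pc≡a))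

  distinct-leaves⇒siblings : ∀ {i ℓ ℓ'} → IsLeaf H i ℓ → IsLeaf H i ℓ' → ℓ ≢ ℓ' →
    ∃[ c ] ∃[ w ] (SibT H i c w × Anc H i c ℓ × Anc H i w ℓ')
  distinct-leaves⇒siblings {i} {ℓ} {ℓ'} ℓ-leaf ℓ'-leaf ℓ≢ℓ'
    with reach i ℓ (proj₁ ℓ-leaf) | reach i ℓ' (proj₁ ℓ'-leaf)
  ... | _ , dℓ | _ , dℓ'
    with lowest-ancestor-off-path dℓ dℓ'
           (λ p → ℓ≢ℓ' (sym (leaf-ancestor-is-self ℓ'-leaf (proj₁ ℓ-leaf) p)))
  ... | w , w-anc , ¬w-anc-ℓ , w≢r , pw-anc
    with child-on-path pw-anc
           (λ pw≡ℓ → proj₂ ℓ-leaf w (Anc⇒InT (proj₁ ℓ'-leaf) w-anc , w≢r , pw≡ℓ))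
  ... | c , c-anc , c≢r , pc≡pw =
    c , w , sibling , c-anc , w-anc
    where
      c≢w : c ≢ w
      c≢w refl = ¬w-anc-ℓ c-anc
      sibling : SibT H i c w
      sibling = c≢w , Anc⇒InT (proj₁ ℓ-leaf) c-anc , Anc⇒InT (proj₁ ℓ'-leaf) w-anc
              , c≢r , w≢r , pc≡pw

  SibT-sym : ∀ {i v w} → SibT H i v w → SibT H i w v
  SibT-sym (v≢w , v∈ , w∈ , v≢r , w≢r , pv≡pw) =
    ≢-sym v≢w , w∈ , v∈ , w≢r , v≢r , sym pv≡pw

  -- A vertex with a sibling is not a leaf, so it belongs to no other tree.
  sibling-tree-unique : ∀ {i c w} → SibT H i c w → ∀ k → InT k c → k ≡ i
  sibling-tree-unique {i} {c} {w} sib k c∈k with k ≟ i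
  ... | yes k≡i = k≡i
  ... | no k≢i  = ⊥-elim (extended i c w (proj₁ (share i k (≢-sym k≢i) c (proj₁ (proj₂ sib)) c∈k)) sib)

  sibling-not-root : ∀ {i c w} → SibT H i c w → ∀ k → c ≢ root k
  sibling-not-root {i} {c} {w} sib k c≡r with sibling-tree-unique sib k (subst (InT k) (sym c≡r) (root-in k))
  ... | refl = proj₁ (proj₂ (proj₂ (proj₂ sib))) c≡r

  sibling-internal : ∀ {i c w} → SibT H i c w → Internal H c
  sibling-internal {i} {c} {w} sib =
    (λ { (k , c≡r) → sibling-not-root sib k c≡r }) ,
    (λ { (k , c-leaf) → extended i c w
           (subst (λ k → IsLeaf H k c) (sibling-tree-unique sib k (proj₁ c-leaf)) c-leaf) sib })

  sibling-internalOf : ∀ {i j ℓ c w} → SibT H i c w → PseudoEdge H i j ℓ →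
                       Anc H i c ℓ → InternalOf H i j ℓ c
  sibling-internalOf {i} {j} {ℓ} {c} {w} sib (_ , ℓ-leaf , _) c-anc =
    inj₁ c-anc , sibling-not-root sib i , sibling-not-root sib j , c≢ℓ
    where
      c≢ℓ : c ≢ ℓ
      c≢ℓ refl = extended i c w ℓ-leaf sib

  shared-leaf-determines-tree : ∀ {i j j' ℓ} →
    PseudoEdge H i j ℓ → PseudoEdge H i j' ℓ → j ≡ j'
  shared-leaf-determines-tree {i} {j} {j'} {ℓ} (i≢j , ℓ-leaf , ℓ-leafj) (i≢j' , _ , ℓ-leafj')
    with leaf-two i ℓ ℓ-leaf
  ... | _ , _ , _ , only with only j ℓ-leafj | only j' ℓ-leafj'
  ...   | inj₁ j≡i  | _          = ⊥-elim (i≢j (sym j≡i))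
  ...   | _         | inj₁ j'≡i  = ⊥-elim (i≢j' (sym j'≡i))
  ...   | inj₂ j≡j₀ | inj₂ j'≡j₀ = trans j≡j₀ (sym j'≡j₀)

  respected-sibling⇒positive-internal : (S : Lit n → Set) (M : List (Fin m × Fin m)) →
    (∀ i j → (i , j) ∈ M → ∀ ℓ → PseudoEdge H i j ℓ → Respects H S i j ℓ) →
    ∀ i j j' ℓ ℓ' → ((i , j) ∈ M ⊎ (j , i) ∈ M) →
    PseudoEdge H i j ℓ → PseudoEdge H i j' ℓ' → root j' ≢ root j →
    ∃[ v ] (InternalOf H i j' ℓ' v × S (pos v))
  respected-sibling⇒positive-internal S M respects i j j' ℓ ℓ' ij∈M e e' tj'≢tj with ℓ ≟ ℓ'
  ... | yes refl = ⊥-elim (tj'≢tj (cong root (sym (shared-leaf-determines-tree e e'))))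
  ... | no ℓ≢ℓ' with distinct-leaves⇒siblings (proj₁ (proj₂ e)) (proj₁ (proj₂ e')) ℓ≢ℓ'
  ...   | c , w , sib , c-anc , w-anc =
    w , sibling-internalOf (SibT-sym sib) e' w-anc , w-positive ij∈M
    where
      c-internal : InternalOf H i j ℓ c
      c-internal = sibling-internalOf sib e c-anc
      c~w : Sib H c w
      c~w = sibling-internal sib , sibling-internal (SibT-sym sib) , i , sib
      w-positive : (i , j) ∈ M ⊎ (j , i) ∈ M → S (pos w)
      w-positive (inj₁ ij∈) = proj₂ (respects i j ij∈ ℓ e) c w c-internal c~w
      w-positive (inj₂ ji∈) = proj₂ (respects j i ji∈ ℓ (PseudoEdge-swap e)) c w
                                    (InternalOf-swap c-internal) c~w

lemma11 : ∀ {n m : ℕ} (H : Forest n m) → IsPseudoexpander H →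
    (M : List (Fin m × Fin m)) → Pseudomatching H M →
    (S : Lit n → Set) → Consistent H S →
    (∀ v → Vars H S v → v ∉ Ends H M) →
    (∀ v → v ∉ Ends H M → Vars H S v) →
    (∀ i j ℓ → PseudoEdge H i j ℓ → ¬ Falsifies H S i j ℓ) →
    (∀ i j → (i , j) ∈ M → ∀ ℓ → PseudoEdge H i j ℓ → Respects H S i j ℓ) →
    ∀ i j j' ℓ ℓ' → ((i , j) ∈ M ⊎ (j , i) ∈ M) →
    PseudoEdge H i j ℓ → PseudoEdge H i j' ℓ' →
    Forest.root H j' ≢ Forest.root H j →
    ∃[ v ] (InternalOf H i j' ℓ' v × S (pos v))
lemma11 H expander M _ S _ _ _ _ respects =
  TreeBased.respected-sibling⇒positive-internal H (IsPseudoexpander.btg expander) S M respects
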